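{- Let $p$ be a prime and let $\Gamma(D_{2p^2})$ be the intersection graph of the dihedral group $D_{2p^2}$. Then the number of edges of $\Gamma(D_{2p^2})$ is $|E(\Gamma(D_{2p^2}))|=\frac{1}{2}(3p^2+3p+2)$.
   Context: For an integer $n\ge 3$, $D_{2n}=\langle r,s : r^n=s^2=1,\ srs=r^{ -1}\rangle$ is the dihedral group of order $2n$. For a finite group $G$, the intersection graph $\Gamma(G)$ is the simple undirected graph whose vertex set is the set of all proper non-trivial subgroups of $G$, with two distinct vertices $H,K$ adjacent if and only if $H\cap K\neq\{e\}$, where $e$ is the identity of $G$. -}

module Defs where

open import Data.Nat using (ℕ; zero; suc; _+_; _∸_; _*_)
open import Data.Nat.DivMod using (_mod_)
open import Data.Bool using (Bool; true; false; not; _∧_; _∨_)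
open import Data.Fin using (Fin; toℕ)
open import Data.Vec using (Vec; []; _∷_; lookup)
open import Data.Product using (_×_; _,_)
open import Data.List using (List; []; _∷_; map; _++_; concatMap; allFin; filterᵇ; length)
open import Data.Bool.ListAction using (all; any)

-- Arithmetic in ℤ/nℤ, realised on Fin n (Fin 0 is empty, so n = 0 is vacuous)

_⊕_ : {n : ℕ} → Fin n → Fin n → Fin n
_⊕_ {suc m} a b = (toℕ a + toℕ b) mod suc m

_⊖_ : {n : ℕ} → Fin n → Fin n → Fin n
_⊖_ {suc m} a b = (toℕ a + (suc m ∸ toℕ b)) mod suc m

-- The dihedral group D_{2n} = ⟨ r , s | r^n = s^2 = 1, s r s = r^{-1} ⟩.
-- The element (k , false) stands for r^k, and (k , true) for r^k s.

Dih : ℕ → Set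
Dih n = Fin n × Bool

-- (r^a s^x)(r^b s^y) = r^(a + (-1)^x b) s^(x+y)
mul : {n : ℕ} → Dih n → Dih n → Dih n
mul (a , false) (b , y) = (a ⊕ b , y)
mul (a , true)  (b , y) = (a ⊖ b , not y)

inv : {n : ℕ} → Dih n → Dih n
inv {n} (a , false) = ((a ⊖ a) ⊖ a , false)
inv (a , true)  = (a , true)

isId : {n : ℕ} → Dih n → Bool
isId (a , false) = Data.Nat._≡ᵇ_ (toℕ a) 0
isId (a , true)  = false

elems : (n : ℕ) → List (Dih n)
elems n = concatMap (λ a → (a , false) ∷ (a , true) ∷ []) (allFin n)

-- Subsets of D_{2n}: a pair of characteristic vectors (rotations, reflections)

DSubset : ℕ → Set
DSubset n = Vec Bool n × Vec Bool n

_∈ᵇ_ : {n : ℕ} → Dih n → DSubset n → Bool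
(a , false) ∈ᵇ (R , S) = lookup R a
(a , true)  ∈ᵇ (R , S) = lookup S a

allVecs : (n : ℕ) → List (Vec Bool n)
allVecs zero    = [] ∷ []
allVecs (suc n) = concatMap (λ v → (false ∷ v) ∷ (true ∷ v) ∷ []) (allVecs n)

allSubsets : (n : ℕ) → List (DSubset n)
allSubsets n = concatMap (λ R → map (λ S → (R , S)) (allVecs n)) (allVecs n)

_⇒ᵇ_ : Bool → Bool → Bool
x ⇒ᵇ y = not x ∨ y

isSubgroup : (n : ℕ) → DSubset n → Bool
isSubgroup n H =
  any (λ x → isId x ∧ (x ∈ᵇ H)) (elems n)
  ∧ all (λ x → all (λ y → (x ∈ᵇ H) ⇒ᵇ ((y ∈ᵇ H) ⇒ᵇ (mul x y ∈ᵇ H))) (elems n)) (elems n)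
  ∧ all (λ x → (x ∈ᵇ H) ⇒ᵇ (inv x ∈ᵇ H)) (elems n)

isProper : (n : ℕ) → DSubset n → Bool
isProper n H = any (λ x → not (x ∈ᵇ H)) (elems n)

isNontrivial : (n : ℕ) → DSubset n → Bool
isNontrivial n H = any (λ x → not (isId x) ∧ (x ∈ᵇ H)) (elems n)

vertices : (n : ℕ) → List (DSubset n)
vertices n = filterᵇ (λ H → isSubgroup n H ∧ isProper n H ∧ isNontrivial n H) (allSubsets n)

adjacent : (n : ℕ) → DSubset n → DSubset n → Bool
adjacent n H K = any (λ x → not (isId x) ∧ (x ∈ᵇ H) ∧ (x ∈ᵇ K)) (elems n)

pairs : {A : Set} → List A → List (A × A)
pairs []       = []
pairs (x ∷ xs) = map (λ y → (x , y)) xs ++ pairs xs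

numEdges : ℕ → ℕ
numEdges n = length (filterᵇ (λ { (H , K) → adjacent n H K }) (pairs (vertices n)))

-- The proper non-trivial subgroups of D_{2p²} are ⟨rᵖ⟩, ⟨r⟩, the p subgroups ⟨rᵖ, rⁱs⟩ (i < p)
-- and the p² subgroups ⟨rʲs⟩ = {e, rʲs}: the rotations of a subgroup form a subgroup of ℤ/p²,
-- generated by 1, p or 0, and its reflections form a single coset of it.  The first 2 + p of them
-- all contain rᵖ, so they are pairwise adjacent; ⟨rʲs⟩ meets another subgroup exactly when that
-- subgroup contains rʲs, which for ⟨rᵖ, rⁱs⟩ means j ≡ i (mod p).  Summing the rows of the
-- adjacency matrix (diagonal included) gives 2|E| + |V| = 2(p + 2) + p(p + 2) + p² + 2p², while
-- |V| = p² + p + 2.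
module Submission where

open import Defs
open import Data.Nat using (ℕ; _+_; _*_; _^_)
open import Data.Nat.Primality using (Prime)
open import Relation.Binary.PropositionalEquality using (_≡_)

open import Data.Bool using (Bool; true; false; not; _∧_; T; T?)
open import Data.Bool.ListAction using (any; all)
open import Data.Bool.Properties using (T-∧; T-≡)
open import Data.Empty using (⊥; ⊥-elim)
open import Data.Fin using (Fin; zero; toℕ; fromℕ<; inject≤)
open import Data.Fin.Properties using (_≟_; any?; toℕ-fromℕ<; toℕ-injective; toℕ<n; toℕ-inject≤)
open import Data.List
  using (List; []; _∷_; map; _++_; filterᵇ; length; concatMap; allFin; cartesianProduct; cartesianProductWith)
open import Data.List.Properties using (map-++; map-∘; map-cong; length-map; length-++; length-tabulate)
open import Data.List.Membership.Propositional using (_∈_; lose)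
open import Data.List.Membership.Propositional.Properties
  using ( ∈-allFin; ∈-cartesianProductWith⁺; ∈-cartesianProduct⁺; ∈-filter⁺; ∈-filter⁻
        ; ∈-++⁺ˡ; ∈-++⁺ʳ; ∈-++⁻; ∈-map⁺; ∈-map⁻)
open import Data.List.Membership.Propositional.Properties.WithK using (unique∧set⇒bag)
open import Data.List.Relation.Binary.BagAndSetEquality using (∼bag⇒↭)
open import Data.List.Relation.Binary.Disjoint.Propositional using (Disjoint)
open import Data.List.Relation.Binary.Permutation.Propositional using (_↭_)
import Data.List.Relation.Binary.Permutation.Propositional.Properties as ↭
open import Data.List.Relation.Unary.All as All using (All; []; _∷_)
open import Data.List.Relation.Unary.All.Properties using (all⁺; all⁻)
open import Data.List.Relation.Unary.AllPairs using ([]; _∷_)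
open import Data.List.Relation.Unary.Any using (here; there; satisfied)
open import Data.List.Relation.Unary.Any.Properties using (any⁺; any⁻)
open import Data.List.Relation.Unary.Unique.Propositional using (Unique)
import Data.List.Relation.Unary.Unique.Propositional.Properties as Unique
open import Data.Nat using (zero; suc; 2+; pred; _∸_; _/_; _%_; _<_; s≤s; z≤n; NonZero; ≢-nonZero)
open import Data.Nat.Coprimality as Coprime using (Coprime; coprime-Bézout; coprime-divisor; prime⇒coprime)
open import Data.Nat.Divisibility using (_∣_; divides; ∣-trans; m%n≡0⇒n∣m; n∣m⇒m%n≡0)
open import Data.Nat.DivMod
  using ( _mod_; %-distribˡ-+; m%n%n≡m%n; [m+n]%n≡m%n; [m+kn]%n≡m%n; m<n⇒m%n≡m; m∣n⇒o%n%m≡o%m; n%n≡0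
        ; m%n*o≡m*o%[n*o]; m/n*n≡m)
open import Data.Nat.GCD using (module Bézout)
open import Data.Nat.ListAction using (sum)
open import Data.Nat.ListAction.Properties using (sum-++; sum-↭)
open import Data.Nat.Primality using (prime⇒irreducible)
open import Data.Nat.Properties
  using (+-assoc; +-comm; +-identityʳ; *-assoc; *-identityˡ; *-identityʳ; *-zeroʳ; +-cancelʳ-≡; *-cancelˡ-≡; *-cancelʳ-<;
         m∸n+n≡m; m+[n∸m]≡n; <⇒≤; <-trans; 0≢1+n; m<m*n; ≡ᵇ⇒≡)
open import Data.Nat.Tactic.RingSolver using (solve-∀)
open import Data.Product using (_×_; _,_; proj₁; proj₂; swap; uncurry; ∃; ∃-syntax)
import Data.Product as Product
open import Data.Sum using (_⊎_; inj₁; inj₂)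
open import Data.Unit using (⊤; tt)
open import Data.Vec using (Vec; []; _∷_; lookup; tabulate)
open import Data.Vec.Properties using (lookup∘tabulate; tabulate∘lookup; tabulate-cong; ∷-injective)
open import Function using (_∘_; _∘′_; id)
open import Function.Bundles using (Equivalence; _⇔_; mk⇔)
open Equivalence using (to; from)
import Function.Properties.Equivalence as ⇔
open import Relation.Binary.Definitions using (DecidableEquality)
open import Relation.Binary.PropositionalEquality using (_≢_; refl; sym; trans; cong; cong₂; subst; module ≡-Reasoning)
open import Relation.Nullary using (¬_)
open import Relation.Nullary.Decidable using (Dec; yes; no; does; dec-true; dec-false; _×-dec_; ¬?; decidable-stable)
open import Relation.Unary using (Decidable)

private variable A B : Set

𝟙 : Bool → ℕ
𝟙 true  = 1
𝟙 false = 0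

∑-syntax : List A → (A → ℕ) → ℕ
∑-syntax xs f = sum (map f xs)

syntax ∑-syntax xs (λ x → e) = ∑[ x ∈ xs ] e

∑-++ : (f : A → ℕ) (xs ys : List A) → ∑[ x ∈ xs ++ ys ] f x ≡ ∑[ x ∈ xs ] f x + ∑[ x ∈ ys ] f x
∑-++ f xs ys = trans (cong sum (map-++ f xs ys)) (sum-++ (map f xs) (map f ys))

∑-map : (f : B → ℕ) (g : A → B) (xs : List A) → ∑[ y ∈ map g xs ] f y ≡ ∑[ x ∈ xs ] f (g x)
∑-map f g xs = cong sum (sym (map-∘ xs))

∑-cong : {f g : A → ℕ} → (∀ x → f x ≡ g x) → (xs : List A) → ∑[ x ∈ xs ] f x ≡ ∑[ x ∈ xs ] g x
∑-cong f≗g xs = cong sum (map-cong f≗g xs)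

∑-const : (c : ℕ) (xs : List A) → ∑[ x ∈ xs ] c ≡ length xs * c
∑-const c [] = refl
∑-const c (x ∷ xs) = cong (c +_) (∑-const c xs)

∑-distrib-+ : (f g : A → ℕ) (xs : List A) → ∑[ x ∈ xs ] (f x + g x) ≡ ∑[ x ∈ xs ] f x + ∑[ x ∈ xs ] g x
∑-distrib-+ f g [] = refl
∑-distrib-+ f g (x ∷ xs) = trans (cong (f x + g x +_) (∑-distrib-+ f g xs)) (swap-middle (f x) (g x) _ _)
  where
  swap-middle : ∀ a b c d → a + b + (c + d) ≡ a + c + (b + d)
  swap-middle = solve-∀

∑-comm : (f : A → B → ℕ) (xs : List A) (ys : List B) →
  ∑[ x ∈ xs ] ∑[ y ∈ ys ] f x y ≡ ∑[ y ∈ ys ] ∑[ x ∈ xs ] f x y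
∑-comm f [] ys = sym (trans (∑-const 0 ys) (*-zeroʳ (length ys)))
∑-comm f (x ∷ xs) ys = trans (cong (∑[ y ∈ ys ] f x y +_) (∑-comm f xs ys))
                            (sym (∑-distrib-+ (f x) (λ y → ∑[ x ∈ xs ] f x y) ys))

∑-↭ : (f : A → ℕ) {xs ys : List A} → xs ↭ ys → ∑[ x ∈ xs ] f x ≡ ∑[ x ∈ ys ] f x
∑-↭ f xs↭ys = sum-↭ (↭.map⁺ f xs↭ys)

∑-cong-∈ : {f g : A → ℕ} (xs : List A) → (∀ {x} → x ∈ xs → f x ≡ g x) →
  ∑[ x ∈ xs ] f x ≡ ∑[ x ∈ xs ] g x
∑-cong-∈ []       _   = refl
∑-cong-∈ (x ∷ xs) f≗g = cong₂ _+_ (f≗g (here refl)) (∑-cong-∈ xs (f≗g ∘ there))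

length-filterᵇ : (P : A → Bool) (xs : List A) → length (filterᵇ P xs) ≡ ∑[ x ∈ xs ] 𝟙 (P x)
length-filterᵇ P [] = refl
length-filterᵇ P (x ∷ xs) with P x
... | true  = cong suc (length-filterᵇ P xs)
... | false = length-filterᵇ P xs

module _ (_≟ₐ_ : DecidableEquality A) where

  count-absent : ∀ {x} {xs : List A} → All (x ≢_) xs → ∑[ y ∈ xs ] 𝟙 (does (x ≟ₐ y)) ≡ 0
  count-absent [] = refl
  count-absent {x} (x≢y ∷ x∉ys) rewrite dec-false (x ≟ₐ _) x≢y = count-absent x∉ys

  count-unique : ∀ {x} {xs : List A} → Unique xs → x ∈ xs → ∑[ y ∈ xs ] 𝟙 (does (x ≟ₐ y)) ≡ 1
  count-unique {x} (x∉xs ∷ _) (here refl) rewrite dec-true (x ≟ₐ x) refl = cong suc (count-absent x∉xs)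
  count-unique {x} {y ∷ _} (y∉ys ∷ ys!) (there x∈ys)
    rewrite dec-false (x ≟ₐ y) (λ { refl → All.lookup y∉ys x∈ys refl }) = count-unique ys! x∈ys

-- Counting edges

edgeCount : (A → A → Bool) → List A → ℕ
edgeCount adj xs = length (filterᵇ (λ { (x , y) → adj x y }) (pairs xs))

edgeCount-∷ : (adj : A → A → Bool) (v : A) (vs : List A) →
  edgeCount adj (v ∷ vs) ≡ ∑[ y ∈ vs ] 𝟙 (adj v y) + edgeCount adj vs
edgeCount-∷ adj v vs = begin
  edgeCount adj (v ∷ vs)
    ≡⟨ length-filterᵇ _ (map (v ,_) vs ++ pairs vs) ⟩
  ∑[ e ∈ map (v ,_) vs ++ pairs vs ] 𝟙 (uncurry adj e)
    ≡⟨ ∑-++ (𝟙 ∘′ uncurry adj) (map (v ,_) vs) (pairs vs) ⟩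
  ∑[ e ∈ map (v ,_) vs ] 𝟙 (uncurry adj e) + ∑[ e ∈ pairs vs ] 𝟙 (uncurry adj e)
    ≡⟨ cong₂ _+_ (∑-map (𝟙 ∘′ uncurry adj) (v ,_) vs) (sym (length-filterᵇ _ (pairs vs))) ⟩
  ∑[ y ∈ vs ] 𝟙 (adj v y) + edgeCount adj vs ∎
  where open ≡-Reasoning

module _ (adj : A → A → Bool) (adj-sym : ∀ x y → adj x y ≡ adj y x) where

  double-counting : ∀ xs →
    2 * edgeCount adj xs + ∑[ x ∈ xs ] 𝟙 (adj x x) ≡ ∑[ x ∈ xs ] ∑[ y ∈ xs ] 𝟙 (adj x y)
  double-counting [] = refl
  double-counting (v ∷ vs) = begin
    2 * edgeCount adj (v ∷ vs) + (𝟙 (adj v v) + diag)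
      ≡⟨ cong (λ e → 2 * e + (𝟙 (adj v v) + diag)) (edgeCount-∷ adj v vs) ⟩
    2 * (row + edgeCount adj vs) + (𝟙 (adj v v) + diag)
      ≡⟨ rearrange row (edgeCount adj vs) (𝟙 (adj v v)) diag ⟩
    𝟙 (adj v v) + row + (row + (2 * edgeCount adj vs + diag))
      ≡⟨ cong₂ (λ c r → 𝟙 (adj v v) + row + (c + r)) column (double-counting vs) ⟩
    𝟙 (adj v v) + row + (∑[ x ∈ vs ] 𝟙 (adj x v) + ∑[ x ∈ vs ] ∑[ y ∈ vs ] 𝟙 (adj x y))
      ≡⟨ cong (𝟙 (adj v v) + row +_) (∑-distrib-+ (λ x → 𝟙 (adj x v)) (λ x → ∑[ y ∈ vs ] 𝟙 (adj x y)) vs) ⟨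
    ∑[ x ∈ v ∷ vs ] ∑[ y ∈ v ∷ vs ] 𝟙 (adj x y) ∎
    where
    open ≡-Reasoning
    row  = ∑[ y ∈ vs ] 𝟙 (adj v y)
    diag = ∑[ x ∈ vs ] 𝟙 (adj x x)
    column : row ≡ ∑[ x ∈ vs ] 𝟙 (adj x v)
    column = ∑-cong (λ x → cong 𝟙 (adj-sym v x)) vs
    rearrange : ∀ r e d s → 2 * (r + e) + (d + s) ≡ d + r + (r + (2 * e + s))
    rearrange = solve-∀

  edgeCount-↭ : {xs ys : List A} → xs ↭ ys → edgeCount adj xs ≡ edgeCount adj ys
  edgeCount-↭ {xs} {ys} xs↭ys = *-cancelˡ-≡ _ _ 2 (+-cancelʳ-≡ _ _ _ (begin
    2 * edgeCount adj xs + ∑[ x ∈ xs ] 𝟙 (adj x x)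
      ≡⟨ double-counting xs ⟩
    ∑[ x ∈ xs ] ∑[ y ∈ xs ] 𝟙 (adj x y)
      ≡⟨ ∑-cong (λ x → ∑-↭ (λ y → 𝟙 (adj x y)) xs↭ys) xs ⟩
    ∑[ x ∈ xs ] ∑[ y ∈ ys ] 𝟙 (adj x y)
      ≡⟨ ∑-↭ (λ x → ∑[ y ∈ ys ] 𝟙 (adj x y)) xs↭ys ⟩
    ∑[ x ∈ ys ] ∑[ y ∈ ys ] 𝟙 (adj x y)
      ≡⟨ double-counting ys ⟨
    2 * edgeCount adj ys + ∑[ x ∈ ys ] 𝟙 (adj x x)
      ≡⟨ cong (2 * edgeCount adj ys +_) (∑-↭ (λ x → 𝟙 (adj x x)) xs↭ys) ⟨
    2 * edgeCount adj ys + ∑[ x ∈ xs ] 𝟙 (adj x x) ∎))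
    where open ≡-Reasoning

concatMap≡cartesianProductWith : {C : Set} (f : A → B → C) (xs : List A) (ys : List B) →
  concatMap (λ x → map (f x) ys) xs ≡ cartesianProductWith f xs ys
concatMap≡cartesianProductWith f [] ys = refl
concatMap≡cartesianProductWith f (x ∷ xs) ys = cong (map (f x) ys ++_) (concatMap≡cartesianProductWith f xs ys)

bools : List Bool
bools = false ∷ true ∷ []

∈-bools : ∀ b → b ∈ bools
∈-bools false = here refl
∈-bools true  = there (here refl)

bools-unique : Unique bools
bools-unique = ((λ ()) ∷ []) ∷ [] ∷ []

allVecs≡cartesianProduct : ∀ n → allVecs (suc n) ≡ cartesianProductWith (λ v b → b ∷ v) (allVecs n) bools
allVecs≡cartesianProduct n = concatMap≡cartesianProductWith (λ v b → b ∷ v) (allVecs n) bools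

∈-allVecs : ∀ {n} (v : Vec Bool n) → v ∈ allVecs n
∈-allVecs [] = here refl
∈-allVecs {suc n} (b ∷ v) = subst ((b ∷ v) ∈_) (sym (allVecs≡cartesianProduct n))
  (∈-cartesianProductWith⁺ (λ v b → b ∷ v) (∈-allVecs v) (∈-bools b))

allVecs-unique : ∀ n → Unique (allVecs n)
allVecs-unique zero = [] ∷ []
allVecs-unique (suc n) = subst Unique (sym (allVecs≡cartesianProduct n))
  (Unique.cartesianProductWith⁺ (λ v b → b ∷ v) (λ eq → swap (∷-injective eq)) (allVecs-unique n) bools-unique)

allSubsets≡cartesianProduct : ∀ n → allSubsets n ≡ cartesianProduct (allVecs n) (allVecs n)
allSubsets≡cartesianProduct n = concatMap≡cartesianProductWith _,_ (allVecs n) (allVecs n)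

∈-allSubsets : ∀ {n} (H : DSubset n) → H ∈ allSubsets n
∈-allSubsets {n} (R , S) = subst ((R , S) ∈_) (sym (allSubsets≡cartesianProduct n))
  (∈-cartesianProduct⁺ (∈-allVecs R) (∈-allVecs S))

allSubsets-unique : ∀ n → Unique (allSubsets n)
allSubsets-unique n = subst Unique (sym (allSubsets≡cartesianProduct n))
  (Unique.cartesianProduct⁺ (allVecs-unique n) (allVecs-unique n))

∈-elems : ∀ {n} (x : Dih n) → x ∈ elems n
∈-elems {n} (a , b) = subst ((a , b) ∈_) (sym (concatMap≡cartesianProductWith _,_ (allFin n) bools))
  (∈-cartesianProduct⁺ (∈-allFin a) (∈-bools b))

isVertex : (n : ℕ) → DSubset n → Bool
isVertex n H = isSubgroup n H ∧ isProper n H ∧ isNontrivial n H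

∈-vertices : ∀ {n} {H : DSubset n} → H ∈ vertices n ⇔ T (isVertex n H)
∈-vertices {n} {H} = mk⇔ (proj₂ ∘′ ∈-filter⁻ vertex? {xs = allSubsets n}) (∈-filter⁺ vertex? (∈-allSubsets H))
  where
  vertex? : ∀ H → Dec (T (isVertex n H))
  vertex? H = T? (isVertex n H)

vertices-unique : ∀ n → Unique (vertices n)
vertices-unique n = Unique.filter⁺ (λ H → T? (isVertex n H)) (allSubsets-unique n)

vertices-↭ : ∀ {n} {Hs : List (DSubset n)} → Unique Hs → (∀ {H} → H ∈ Hs ⇔ T (isVertex n H)) → vertices n ↭ Hs
vertices-↭ {n} Hs! ∈Hs⇔ =
  ∼bag⇒↭ (unique∧set⇒bag (vertices-unique n) Hs! (⇔.trans ∈-vertices (⇔.sym ∈Hs⇔)))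

T-injective : ∀ {a b} → T a ⇔ T b → a ≡ b
T-injective {false} {false} _ = refl
T-injective {false} {true}  e = ⊥-elim (from e tt)
T-injective {true}  {false} e = ⊥-elim (to e tt)
T-injective {true}  {true}  _ = refl

T-not : ∀ {a} → T (not a) ⇔ (¬ T a)
T-not {false} = mk⇔ (λ _ ()) (λ _ → tt)
T-not {true}  = mk⇔ (λ ()) (λ ¬t → ¬t tt)

T-does : {P : Set} (P? : Dec P) → T (does P?) ⇔ P
T-does (yes p) = mk⇔ (λ _ → p) (λ _ → tt)
T-does (no ¬p) = mk⇔ (λ ()) ¬p

T-⇒ᵇ : ∀ a b → T (a ⇒ᵇ b) ⇔ (T a → T b)
T-⇒ᵇ false _ = mk⇔ (λ _ ()) (λ _ → tt)
T-⇒ᵇ true  _ = mk⇔ (λ t _ → t) (λ f → f tt)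

-- Arithmetic modulo n

[m%n+o]%n≡[m+o]%n : ∀ x y n .{{_ : NonZero n}} → (x % n + y) % n ≡ (x + y) % n
[m%n+o]%n≡[m+o]%n x y n = begin
  (x % n + y) % n         ≡⟨ %-distribˡ-+ (x % n) y n ⟩
  (x % n % n + y % n) % n ≡⟨ cong (λ z → (z + y % n) % n) (m%n%n≡m%n x n) ⟩
  (x % n + y % n) % n     ≡⟨ %-distribˡ-+ x y n ⟨
  (x + y) % n             ∎
  where open ≡-Reasoning

module _ {m : ℕ} where

  toℕ-⊕ : (a b : Fin (suc m)) → toℕ (a ⊕ b) ≡ (toℕ a + toℕ b) % suc m
  toℕ-⊕ a b = toℕ-fromℕ< _

  toℕ-⊖ : (a b : Fin (suc m)) → toℕ (a ⊖ b) ≡ (toℕ a + (suc m ∸ toℕ b)) % suc m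
  toℕ-⊖ a b = toℕ-fromℕ< _

  private
    [a+n]%n≡a : (a : Fin (suc m)) → (toℕ a + suc m) % suc m ≡ toℕ a
    [a+n]%n≡a a = trans ([m+n]%n≡m%n (toℕ a) (suc m)) (m<n⇒m%n≡m (toℕ<n a))

  ⊕-identityˡ : (a : Fin (suc m)) → zero ⊕ a ≡ a
  ⊕-identityˡ a = toℕ-injective (trans (toℕ-⊕ zero a) (m<n⇒m%n≡m (toℕ<n a)))

  ⊕-identityʳ : (a : Fin (suc m)) → a ⊕ zero ≡ a
  ⊕-identityʳ a = toℕ-injective (trans (toℕ-⊕ a zero)
    (trans (cong (_% suc m) (+-identityʳ (toℕ a))) (m<n⇒m%n≡m (toℕ<n a))))

  ⊖-⊕-cancel : (a b : Fin (suc m)) → (a ⊖ b) ⊕ b ≡ a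
  ⊖-⊕-cancel a b = toℕ-injective (begin
    toℕ ((a ⊖ b) ⊕ b)
      ≡⟨ toℕ-⊕ (a ⊖ b) b ⟩
    (toℕ (a ⊖ b) + toℕ b) % suc m
      ≡⟨ cong (λ z → (z + toℕ b) % suc m) (toℕ-⊖ a b) ⟩
    ((toℕ a + (suc m ∸ toℕ b)) % suc m + toℕ b) % suc m
      ≡⟨ [m%n+o]%n≡[m+o]%n (toℕ a + (suc m ∸ toℕ b)) (toℕ b) (suc m) ⟩
    (toℕ a + (suc m ∸ toℕ b) + toℕ b) % suc m
      ≡⟨ cong (_% suc m) (+-assoc (toℕ a) _ (toℕ b)) ⟩
    (toℕ a + ((suc m ∸ toℕ b) + toℕ b)) % suc m
      ≡⟨ cong (λ z → (toℕ a + z) % suc m) (m∸n+n≡m (<⇒≤ (toℕ<n b))) ⟩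
    (toℕ a + suc m) % suc m
      ≡⟨ [a+n]%n≡a a ⟩
    toℕ a ∎)
    where open ≡-Reasoning

  ⊕-⊖-cancel : (a b : Fin (suc m)) → (a ⊕ b) ⊖ b ≡ a
  ⊕-⊖-cancel a b = toℕ-injective (begin
    toℕ ((a ⊕ b) ⊖ b)
      ≡⟨ toℕ-⊖ (a ⊕ b) b ⟩
    (toℕ (a ⊕ b) + (suc m ∸ toℕ b)) % suc m
      ≡⟨ cong (λ z → (z + (suc m ∸ toℕ b)) % suc m) (toℕ-⊕ a b) ⟩
    ((toℕ a + toℕ b) % suc m + (suc m ∸ toℕ b)) % suc m
      ≡⟨ [m%n+o]%n≡[m+o]%n (toℕ a + toℕ b) (suc m ∸ toℕ b) (suc m) ⟩
    (toℕ a + toℕ b + (suc m ∸ toℕ b)) % suc m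
      ≡⟨ cong (_% suc m) (+-assoc (toℕ a) (toℕ b) _) ⟩
    (toℕ a + (toℕ b + (suc m ∸ toℕ b))) % suc m
      ≡⟨ cong (λ z → (toℕ a + z) % suc m) (m+[n∸m]≡n (<⇒≤ (toℕ<n b))) ⟩
    (toℕ a + suc m) % suc m
      ≡⟨ [a+n]%n≡a a ⟩
    toℕ a ∎)
    where open ≡-Reasoning

  ⊕-cancelʳ : ∀ {a b} (c : Fin (suc m)) → a ⊕ c ≡ b ⊕ c → a ≡ b
  ⊕-cancelʳ {a} {b} c eq = trans (sym (⊕-⊖-cancel a c)) (trans (cong (_⊖ c) eq) (⊕-⊖-cancel b c))

  ⊖-self : (a : Fin (suc m)) → a ⊖ a ≡ zero
  ⊖-self a = trans (cong (_⊖ a) (sym (⊕-identityˡ a))) (⊕-⊖-cancel zero a)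

  ⊖-identityʳ : (a : Fin (suc m)) → a ⊖ zero ≡ a
  ⊖-identityʳ a = trans (sym (⊕-identityʳ (a ⊖ zero))) (⊖-⊕-cancel a zero)

  ⊖≡zero⇔≡ : {a b : Fin (suc m)} → a ⊖ b ≡ zero ⇔ a ≡ b
  ⊖≡zero⇔≡ {a} {b} = mk⇔
    (λ a⊖b≡0 → trans (sym (⊖-⊕-cancel a b)) (trans (cong (_⊕ b) a⊖b≡0) (⊕-identityˡ b)))
    (λ { refl → ⊖-self a })

  _·_ : ℕ → Fin (suc m) → Fin (suc m)
  zero  · a = zero
  suc k · a = a ⊕ (k · a)

  toℕ-· : ∀ k (a : Fin (suc m)) → toℕ (k · a) ≡ k * toℕ a % suc m
  toℕ-· zero    a = refl
  toℕ-· (suc k) a = begin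
    toℕ (a ⊕ (k · a))                   ≡⟨ toℕ-⊕ a (k · a) ⟩
    (toℕ a + toℕ (k · a)) % suc m       ≡⟨ cong (λ z → (toℕ a + z) % suc m) (toℕ-· k a) ⟩
    (toℕ a + k * toℕ a % suc m) % suc m ≡⟨ cong (_% suc m) (+-comm (toℕ a) _) ⟩
    (k * toℕ a % suc m + toℕ a) % suc m ≡⟨ [m%n+o]%n≡[m+o]%n (k * toℕ a) (toℕ a) (suc m) ⟩
    (k * toℕ a + toℕ a) % suc m         ≡⟨ cong (_% suc m) (+-comm (k * toℕ a) (toℕ a)) ⟩
    suc k * toℕ a % suc m               ∎
    where open ≡-Reasoning

  k*a≡c⇒k·a≡c : ∀ k {a c : Fin (suc m)} → k * toℕ a ≡ toℕ c → k · a ≡ c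
  k*a≡c⇒k·a≡c k {a} {c} eq = toℕ-injective (trans (toℕ-· k a) (trans (cong (_% suc m) eq) (m<n⇒m%n≡m (toℕ<n c))))

coprime⇒inverse : ∀ {t} m → Coprime t (2+ m) → ∃[ k ] k * t % 2+ m ≡ 1
coprime⇒inverse {t} m t⊥n with coprime-Bézout t⊥n
... | Bézout.+- x y 1+yn≡xt = x , (begin
  x * t % n       ≡⟨ cong (_% n) 1+yn≡xt ⟨
  (1 + y * n) % n ≡⟨ [m+kn]%n≡m%n 1 y n ⟩
  1               ∎)
  where
  open ≡-Reasoning
  n = 2+ m
... | Bézout.-+ x y 1+xt≡yn = suc m * x , (begin
  suc m * x * t % n             ≡⟨ [m+n]%n≡m%n (suc m * x * t) n ⟨
  (suc m * x * t + n) % n       ≡⟨ cong (_% n) (expand (suc m) x t) ⟩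
  (suc m * (1 + x * t) + 1) % n ≡⟨ cong (λ z → (suc m * z + 1) % n) 1+xt≡yn ⟩
  (suc m * (y * n) + 1) % n     ≡⟨ cong (_% n) (regroup (suc m) y) ⟩
  (1 + suc m * y * n) % n       ≡⟨ [m+kn]%n≡m%n 1 (suc m * y) n ⟩
  1                             ∎)
  where
  open ≡-Reasoning
  n = 2+ m
  expand : ∀ a x t → a * x * t + suc a ≡ a * (1 + x * t) + 1
  expand = solve-∀
  regroup : ∀ a y → a * (y * suc a) + 1 ≡ 1 + a * y * suc a
  regroup = solve-∀

coprime-*ʳ : ∀ {t a b} → Coprime t a → Coprime t b → Coprime t (a * b)
coprime-*ʳ {t} {a} t⊥a t⊥b {d} (d∣t , d∣ab) = t⊥b (d∣t , coprime-divisor d⊥a d∣ab)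
  where
  d⊥a : Coprime d a
  d⊥a (e∣d , e∣a) = t⊥a (∣-trans e∣d d∣t , e∣a)

prime∤⇒coprime : ∀ {p t} → Prime p → ¬ p ∣ t → Coprime t p
prime∤⇒coprime p-prime p∤t (d∣t , d∣p) with prime⇒irreducible p-prime d∣p
... | inj₁ d≡1  = d≡1
... | inj₂ refl = ⊥-elim (p∤t d∣t)

-- Subgroups of dihedral groups

ε : ∀ {m} → Dih (suc m)
ε = (zero , false)

record IsSubgroup {m} (P : Dih (suc m) → Set) : Set where
  field
    ε∈        : P ε
    ∙-closed  : ∀ x y → P x → P y → P (mul x y)
    ⁻¹-closed : ∀ x → P x → P (inv x)

record IsHomomorphism {m k} (f : Dih (suc m) → Dih (suc k)) : Set where
  field
    ε-hom  : f ε ≡ ε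
    ∙-hom  : ∀ x y → f (mul x y) ≡ mul (f x) (f y)
    ⁻¹-hom : ∀ x → f (inv x) ≡ inv (f x)

module _ {m : ℕ} {P Q : Dih (suc m) → Set} where

  IsSubgroup-resp : (∀ x → P x ⇔ Q x) → IsSubgroup P → IsSubgroup Q
  IsSubgroup-resp P⇔Q P-sub = record
    { ε∈        = to (P⇔Q ε) ε∈
    ; ∙-closed  = λ x y qx qy → to (P⇔Q (mul x y)) (∙-closed x y (from (P⇔Q x) qx) (from (P⇔Q y) qy))
    ; ⁻¹-closed = λ x qx → to (P⇔Q (inv x)) (⁻¹-closed x (from (P⇔Q x) qx))
    }
    where open IsSubgroup P-sub

IsSubgroup-preimage : ∀ {m k} {f : Dih (suc m) → Dih (suc k)} {P : Dih (suc k) → Set} →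
  IsHomomorphism f → IsSubgroup P → IsSubgroup (P ∘ f)
IsSubgroup-preimage {f = f} {P} f-hom P-sub = record
  { ε∈        = subst P (sym ε-hom) ε∈
  ; ∙-closed  = λ x y px py → subst P (sym (∙-hom x y)) (∙-closed (f x) (f y) px py)
  ; ⁻¹-closed = λ x px → subst P (sym (⁻¹-hom x)) (⁻¹-closed (f x) px)
  }
  where open IsHomomorphism f-hom; open IsSubgroup P-sub

module _ {m : ℕ} where

  Trivial : Dih (suc m) → Set
  Trivial (a , false) = a ≡ zero
  Trivial (a , true)  = ⊥

  Rotation : Dih (suc m) → Set
  Rotation (_ , false) = ⊤
  Rotation (_ , true)  = ⊥

  Flip : Fin (suc m) → Dih (suc m) → Set
  Flip j (a , false) = a ≡ zero
  Flip j (a , true)  = a ≡ j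

  trivial? : Decidable Trivial
  trivial? (a , false) = a ≟ zero
  trivial? (a , true)  = no id

  rotation? : Decidable Rotation
  rotation? (_ , false) = yes tt
  rotation? (_ , true)  = no id

  flip? : (j : Fin (suc m)) → Decidable (Flip j)
  flip? j (a , false) = a ≟ zero
  flip? j (a , true)  = a ≟ j

  private
    inv-ε : inv {suc m} ε ≡ ε
    inv-ε = cong (_, false) (trans (cong (_⊖ zero) (⊖-self zero)) (⊖-self zero))

  Trivial-subgroup : IsSubgroup Trivial
  Trivial-subgroup = record
    { ε∈        = refl
    ; ∙-closed  = λ { (_ , false) (_ , false) refl refl → ⊕-identityˡ zero }
    ; ⁻¹-closed = λ { (_ , false) refl → cong proj₁ inv-ε }
    }

  Rotation-subgroup : IsSubgroup Rotation
  Rotation-subgroup = record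
    { ε∈        = tt
    ; ∙-closed  = λ { (_ , false) (_ , false) _ _ → tt }
    ; ⁻¹-closed = λ { (_ , false) _ → tt }
    }

  Flip-subgroup : ∀ j → IsSubgroup (Flip j)
  Flip-subgroup j = record
    { ε∈        = refl
    ; ∙-closed  = λ
        { (_ , false) (_ , false) refl refl → ⊕-identityˡ zero
        ; (_ , false) (_ , true)  refl refl → ⊕-identityˡ j
        ; (_ , true)  (_ , false) refl refl → ⊖-identityʳ j
        ; (_ , true)  (_ , true)  refl refl → ⊖-self j
        }
    ; ⁻¹-closed = λ { (_ , false) refl → cong proj₁ inv-ε ; (_ , true) refl → refl }
    }

module Reduction {m k : ℕ} (k+1∣m+1 : suc k ∣ suc m) where

  reduce : Fin (suc m) → Fin (suc k)
  reduce a = toℕ a mod suc k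

  toℕ-reduce : (a : Fin (suc m)) → toℕ (reduce a) ≡ toℕ a % suc k
  toℕ-reduce a = toℕ-fromℕ< _

  reduce-⊕ : (a b : Fin (suc m)) → reduce (a ⊕ b) ≡ reduce a ⊕ reduce b
  reduce-⊕ a b = toℕ-injective (begin
    toℕ (reduce (a ⊕ b))                        ≡⟨ toℕ-reduce (a ⊕ b) ⟩
    toℕ (a ⊕ b) % suc k                         ≡⟨ cong (_% suc k) (toℕ-⊕ a b) ⟩
    (toℕ a + toℕ b) % suc m % suc k             ≡⟨ m∣n⇒o%n%m≡o%m (suc k) (suc m) (toℕ a + toℕ b) k+1∣m+1 ⟩
    (toℕ a + toℕ b) % suc k                     ≡⟨ %-distribˡ-+ (toℕ a) (toℕ b) (suc k) ⟩
    (toℕ a % suc k + toℕ b % suc k) % suc k     ≡⟨ cong₂ (λ x y → (x + y) % suc k) (toℕ-reduce a) (toℕ-reduce b) ⟨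
    (toℕ (reduce a) + toℕ (reduce b)) % suc k   ≡⟨ toℕ-⊕ (reduce a) (reduce b) ⟨
    toℕ (reduce a ⊕ reduce b)                   ∎)
    where open ≡-Reasoning

  -- Both sides are the unique solution x of x ⊕ reduce b ≡ reduce a.
  reduce-⊖ : (a b : Fin (suc m)) → reduce (a ⊖ b) ≡ reduce a ⊖ reduce b
  reduce-⊖ a b = ⊕-cancelʳ (reduce b) (begin
    reduce (a ⊖ b) ⊕ reduce b     ≡⟨ reduce-⊕ (a ⊖ b) b ⟨
    reduce ((a ⊖ b) ⊕ b)          ≡⟨ cong reduce (⊖-⊕-cancel a b) ⟩
    reduce a                      ≡⟨ ⊖-⊕-cancel (reduce a) (reduce b) ⟨
    (reduce a ⊖ reduce b) ⊕ reduce b ∎)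
    where open ≡-Reasoning

  π : Dih (suc m) → Dih (suc k)
  π (a , b) = (reduce a , b)

  π-hom : IsHomomorphism π
  π-hom = record
    { ε-hom  = refl
    ; ∙-hom  = λ { (a , false) (b , y) → cong (_, y) (reduce-⊕ a b)
                 ; (a , true)  (b , y) → cong (_, not y) (reduce-⊖ a b) }
    ; ⁻¹-hom = λ { (a , false) → cong (_, false) (trans (reduce-⊖ (a ⊖ a) a) (cong (_⊖ reduce a) (reduce-⊖ a a)))
                 ; (a , true)  → refl }
    }

_∈ˢ_ : ∀ {n} → Dih n → DSubset n → Set
x ∈ˢ H = T (x ∈ᵇ H)

module _ {n : ℕ} where

  any-elems : (f : Dih n → Bool) → T (any f (elems n)) ⇔ (∃[ x ] T (f x))
  any-elems f = mk⇔ (λ t → satisfied (any⁻ f (elems n) t)) (λ (x , fx) → any⁺ f (lose (∈-elems x) fx))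

  all-elems : (f : Dih n → Bool) → T (all f (elems n)) ⇔ (∀ x → T (f x))
  all-elems f = mk⇔ (λ t x → All.lookup (all⁺ f (elems n) t) (∈-elems x))
                      (λ h → all⁻ f {xs = elems n} (All.tabulate (λ {x} _ → h x)))

  isProper⇔ : (H : DSubset n) → T (isProper n H) ⇔ (∃[ x ] ¬ x ∈ˢ H)
  isProper⇔ H = mk⇔ (λ t → let (x , t′) = to any-∉ t in x , to (T-not {x ∈ᵇ H}) t′)
                      (λ (x , x∉H) → from any-∉ (x , from (T-not {x ∈ᵇ H}) x∉H))
    where
    any-∉ = any-elems (λ x → not (x ∈ᵇ H))

  fromDec : {P : Dih n → Set} → Decidable P → DSubset n
  fromDec P? = tabulate (λ a → does (P? (a , false))) , tabulate (λ a → does (P? (a , true)))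

  ∈ᵇ-fromDec : {P : Dih n → Set} (P? : Decidable P) (x : Dih n) → x ∈ᵇ fromDec P? ≡ does (P? x)
  ∈ᵇ-fromDec P? (a , false) = lookup∘tabulate _ a
  ∈ᵇ-fromDec P? (a , true)  = lookup∘tabulate _ a

  ∈ˢ-fromDec : {P : Dih n → Set} (P? : Decidable P) (x : Dih n) → x ∈ˢ fromDec P? ⇔ P x
  ∈ˢ-fromDec P? x = ⇔.trans (mk⇔ (subst T eq) (subst T (sym eq))) (T-does (P? x))
    where eq = ∈ᵇ-fromDec P? x

  DSubset-ext : {H K : DSubset n} → (∀ x → x ∈ˢ H ⇔ x ∈ˢ K) → H ≡ K
  DSubset-ext {R , S} {R′ , S′} H⇔K =
    cong₂ _,_ (Vec-ext (λ a → T-injective (H⇔K (a , false)))) (Vec-ext (λ a → T-injective (H⇔K (a , true))))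
    where
    Vec-ext : {U V : Vec Bool n} → (∀ a → lookup U a ≡ lookup V a) → U ≡ V
    Vec-ext {U} {V} eq = trans (sym (tabulate∘lookup U)) (trans (tabulate-cong eq) (tabulate∘lookup V))

module _ {m : ℕ} where

  isId⇔ : (x : Dih (suc m)) → T (isId x) ⇔ x ≡ ε
  isId⇔ (a , false) = mk⇔ (λ t → cong (_, false) (toℕ-injective (≡ᵇ⇒≡ (toℕ a) 0 t))) (λ { refl → tt })
  isId⇔ (a , true)  = mk⇔ (λ ()) (λ ())

  nonId∧⇔ : (x : Dih (suc m)) (b : Bool) → T (not (isId x) ∧ b) ⇔ (x ≢ ε × T b)
  nonId∧⇔ x b = mk⇔
    (λ t → let (t₁ , t₂) = to (T-∧ {not (isId x)}) t in (λ x≡ε → to (T-not {isId x}) t₁ (from (isId⇔ x) x≡ε)) , t₂)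
    (λ (x≢ε , t) → from (T-∧ {not (isId x)}) (from (T-not {isId x}) (λ t′ → x≢ε (to (isId⇔ x) t′)) , t))

  isSubgroup⇔ : (H : DSubset (suc m)) → T (isSubgroup (suc m) H) ⇔ IsSubgroup (_∈ˢ H)
  isSubgroup⇔ H = mk⇔ subgroup boolean
    where
    id∈ closedᵇ inv-closedᵇ : Dih (suc m) → Bool
    id∈ x = isId x ∧ (x ∈ᵇ H)
    closed : Dih (suc m) → Dih (suc m) → Bool
    closed x y = (x ∈ᵇ H) ⇒ᵇ ((y ∈ᵇ H) ⇒ᵇ (mul x y ∈ᵇ H))
    closedᵇ x = all (closed x) (elems (suc m))
    inv-closedᵇ x = (x ∈ᵇ H) ⇒ᵇ (inv x ∈ᵇ H)
    identity mul-closed inv-closed : Bool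
    identity   = any id∈ (elems (suc m))
    mul-closed = all closedᵇ (elems (suc m))
    inv-closed = all inv-closedᵇ (elems (suc m))
    split : T (isSubgroup (suc m) H) ⇔ (T identity × T mul-closed × T inv-closed)
    split = ⇔.trans (T-∧ {identity})
                    (mk⇔ (Product.map₂ (to (T-∧ {mul-closed}))) (Product.map₂ (from (T-∧ {mul-closed}))))
    subgroup : T (isSubgroup (suc m) H) → IsSubgroup (_∈ˢ H)
    subgroup t = record
      { ε∈        = let (x , t′) = to (any-elems id∈) identity-t ; (x≡ε , x∈H) = to (T-∧ {isId x}) t′
                    in subst (_∈ˢ H) (to (isId⇔ x) x≡ε) x∈H
      ; ∙-closed  = λ x y x∈H y∈H →
          to (T-⇒ᵇ (y ∈ᵇ H) _) (to (T-⇒ᵇ (x ∈ᵇ H) _) (to (all-elems (closed x)) (to (all-elems closedᵇ) mul-t x) y) x∈H) y∈H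
      ; ⁻¹-closed = λ x x∈H → to (T-⇒ᵇ (x ∈ᵇ H) (inv x ∈ᵇ H)) (to (all-elems inv-closedᵇ) inv-t x) x∈H
      }
      where identity-t = proj₁ (to split t); mul-t = proj₁ (proj₂ (to split t)); inv-t = proj₂ (proj₂ (to split t))
    boolean : IsSubgroup (_∈ˢ H) → T (isSubgroup (suc m) H)
    boolean H-sub = from split
      ( from (any-elems id∈) (ε , from (T-∧ {isId (ε {m})} {ε ∈ᵇ H}) (from (isId⇔ ε) refl , ε∈))
      , from (all-elems closedᵇ) (λ x → from (all-elems (closed x)) (λ y →
          from (T-⇒ᵇ (x ∈ᵇ H) _) (λ x∈H → from (T-⇒ᵇ (y ∈ᵇ H) _) (λ y∈H → ∙-closed x y x∈H y∈H))))
      , from (all-elems inv-closedᵇ) (λ x → from (T-⇒ᵇ (x ∈ᵇ H) (inv x ∈ᵇ H)) (⁻¹-closed x)))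
      where open IsSubgroup H-sub

  isNontrivial⇔ : (H : DSubset (suc m)) → T (isNontrivial (suc m) H) ⇔ (∃[ x ] x ≢ ε × x ∈ˢ H)
  isNontrivial⇔ H = mk⇔ (λ t → let (x , t′) = to any-∈ t in x , to (nonId∧⇔ x (x ∈ᵇ H)) t′)
                        (λ (x , x≢ε , x∈H) → from any-∈ (x , from (nonId∧⇔ x (x ∈ᵇ H)) (x≢ε , x∈H)))
    where
    any-∈ = any-elems (λ x → not (isId x) ∧ (x ∈ᵇ H))

  IsVertex : DSubset (suc m) → Set
  IsVertex H = IsSubgroup (_∈ˢ H) × (∃[ x ] ¬ x ∈ˢ H) × (∃[ x ] x ≢ ε × x ∈ˢ H)

  isVertex⇔ : (H : DSubset (suc m)) → T (isVertex (suc m) H) ⇔ IsVertex H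
  isVertex⇔ H = mk⇔
    (λ t → let (t₁ , t₂₃) = to (T-∧ {isSubgroup _ H}) t ; (t₂ , t₃) = to (T-∧ {isProper _ H}) t₂₃
           in to (isSubgroup⇔ H) t₁ , to (isProper⇔ H) t₂ , to (isNontrivial⇔ H) t₃)
    (λ (sub , prop , nontriv) → from (T-∧ {isSubgroup _ H})
      (from (isSubgroup⇔ H) sub , from (T-∧ {isProper _ H}) (from (isProper⇔ H) prop , from (isNontrivial⇔ H) nontriv)))

  adjacent⇔ : (H K : DSubset (suc m)) → T (adjacent (suc m) H K) ⇔ (∃[ x ] x ≢ ε × x ∈ˢ H × x ∈ˢ K)
  adjacent⇔ H K = mk⇔
    (λ t → let (x , t′) = to any-∈ t ; (x≢ε , t″) = to (nonId∧⇔ x _) t′ in x , x≢ε , to (T-∧ {x ∈ᵇ H}) t″)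
    (λ (x , x≢ε , x∈H , x∈K) → from any-∈ (x , from (nonId∧⇔ x _) (x≢ε , from (T-∧ {x ∈ᵇ H}) (x∈H , x∈K))))
    where
    any-∈ = any-elems (λ x → not (isId x) ∧ (x ∈ᵇ H) ∧ (x ∈ᵇ K))

  adjacent-sym : (H K : DSubset (suc m)) → adjacent (suc m) H K ≡ adjacent (suc m) K H
  adjacent-sym H K = T-injective (mk⇔ swap-witness swap-witness)
    where
    swap-witness : ∀ {H K} → T (adjacent (suc m) H K) → T (adjacent (suc m) K H)
    swap-witness t = let (x , x≢ε , x∈H , x∈K) = to (adjacent⇔ _ _) t in from (adjacent⇔ _ _) (x , x≢ε , x∈K , x∈H)

  adjacent-at : {H K : DSubset (suc m)} (x : Dih (suc m)) → x ≢ ε → x ∈ˢ H → x ∈ˢ K → adjacent (suc m) H K ≡ true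
  adjacent-at x x≢ε x∈H x∈K = to T-≡ (from (adjacent⇔ _ _) (x , x≢ε , x∈H , x∈K))

  nontrivial-self-adjacent : {H : DSubset (suc m)} → (∃[ x ] x ≢ ε × x ∈ˢ H) → adjacent (suc m) H H ≡ true
  nontrivial-self-adjacent (x , x≢ε , x∈H) = adjacent-at x x≢ε x∈H x∈H

  -- The only non-identity element of Flip j is rʲ s.
  adjacent-Flip : (H : DSubset (suc m)) (j : Fin (suc m)) → adjacent (suc m) H (fromDec (flip? j)) ≡ (j , true) ∈ᵇ H
  adjacent-Flip H j = T-injective (mk⇔ reflection-in-H witness)
    where
    reflection-in-H : T (adjacent (suc m) H (fromDec (flip? j))) → (j , true) ∈ˢ H
    reflection-in-H t with to (adjacent⇔ H (fromDec (flip? j))) t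
    ... | (a , false) , x≢ε , _ , x∈F = ⊥-elim (x≢ε (cong (_, false) (to (∈ˢ-fromDec (flip? j) (a , false)) x∈F)))
    ... | (a , true)  , _ , x∈H , x∈F = subst (λ c → (c , true) ∈ˢ H) (to (∈ˢ-fromDec (flip? j) (a , true)) x∈F) x∈H
    witness : (j , true) ∈ˢ H → T (adjacent (suc m) H (fromDec (flip? j)))
    witness t = from (adjacent⇔ H (fromDec (flip? j)))
                     ((j , true) , (λ ()) , t , from (∈ˢ-fromDec (flip? j) (j , true)) refl)

  fromDec-vertex : {P : Dih (suc m) → Set} (P? : Decidable P) → IsSubgroup P →
    (x : Dih (suc m)) → ¬ P x → (y : Dih (suc m)) → y ≢ ε → P y → T (isVertex (suc m) (fromDec P?))
  fromDec-vertex P? P-sub x ¬Px y y≢ε Py = from (isVertex⇔ (fromDec P?))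
    ( IsSubgroup-resp (λ z → ⇔.sym (∈ˢ-fromDec P? z)) P-sub
    , (x , ¬Px ∘ to (∈ˢ-fromDec P? x))
    , (y , y≢ε , from (∈ˢ-fromDec P? y) Py))

-- The intersection graph of D_{2p²}

module D2p² (q : ℕ) where

  -- p = q + 2, so that p and n = p * p are syntactically successors.
  p n : ℕ
  p = 2+ q
  n = p * p

  open Reduction {m = pred n} {k = suc q} (divides p refl)

  p<n : p < n
  p<n = m<m*n p p (s≤s (s≤s z≤n))

  r¹ rᵖ : Dih n
  r¹ = (fromℕ< (<-trans (s≤s (s≤s z≤n)) p<n) , false)
  rᵖ = (fromℕ< p<n , false)

  rᵖ≢ε : rᵖ ≢ ε
  rᵖ≢ε rᵖ≡ε = 0≢1+n (trans (sym (cong (toℕ ∘ proj₁) rᵖ≡ε)) (toℕ-fromℕ< p<n))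

  reduce-p≡zero : reduce (fromℕ< p<n) ≡ zero
  reduce-p≡zero = toℕ-injective (trans (toℕ-reduce (fromℕ< p<n)) (trans (cong (_% p) (toℕ-fromℕ< p<n)) (n%n≡0 p)))

  reduce-1≢zero : reduce (proj₁ r¹) ≢ zero
  reduce-1≢zero ()

  ι : Fin p → Fin n
  ι i = inject≤ i (<⇒≤ p<n)

  reduce-ι : (i : Fin p) → reduce (ι i) ≡ i
  reduce-ι i = toℕ-injective (trans (toℕ-reduce (ι i)) (trans (cong (_% p) (toℕ-inject≤ i _)) (m<n⇒m%n≡m (toℕ<n i))))

  ⟨rᵖ⟩ ⟨r⟩ : DSubset n
  ⟨rᵖ⟩ = fromDec (trivial? ∘ π)
  ⟨r⟩  = fromDec rotation?

  ⟨rᵖ,rⁱs⟩ : Fin p → DSubset n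
  ⟨rᵖ,rⁱs⟩ i = fromDec (flip? i ∘ π)

  ⟨rʲs⟩ : Fin n → DSubset n
  ⟨rʲs⟩ j = fromDec (flip? j)

  with-reflections subgroups : List (DSubset n)
  with-reflections = map ⟨rᵖ,rⁱs⟩ (allFin p) ++ map ⟨rʲs⟩ (allFin n)
  subgroups        = ⟨rᵖ⟩ ∷ ⟨r⟩ ∷ with-reflections

  subgroup⇒vertex : ∀ {H} → H ∈ subgroups → T (isVertex n H)
  subgroup⇒vertex (here refl) =
    fromDec-vertex (trivial? ∘ π) (IsSubgroup-preimage π-hom Trivial-subgroup) (zero , true) id rᵖ rᵖ≢ε reduce-p≡zero
  subgroup⇒vertex (there (here refl)) =
    fromDec-vertex rotation? Rotation-subgroup (zero , true) id rᵖ rᵖ≢ε tt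
  subgroup⇒vertex (there (there H∈)) with ∈-++⁻ (map ⟨rᵖ,rⁱs⟩ (allFin p)) {map ⟨rʲs⟩ (allFin n)} H∈
  ... | inj₁ H∈F with i , _ , refl ← ∈-map⁻ ⟨rᵖ,rⁱs⟩ {xs = allFin p} H∈F =
    fromDec-vertex (flip? i ∘ π) (IsSubgroup-preimage π-hom (Flip-subgroup i)) r¹ reduce-1≢zero rᵖ rᵖ≢ε reduce-p≡zero
  ... | inj₂ H∈F with j , _ , refl ← ∈-map⁻ ⟨rʲs⟩ {xs = allFin n} H∈F =
    fromDec-vertex (flip? j) (Flip-subgroup j) r¹ (λ ()) (j , true) (λ ()) refl

  separated : {H K : DSubset n} (x : Dih n) → x ∈ˢ H → ¬ x ∈ˢ K → H ≢ K
  separated x x∈H x∉K refl = x∉K x∈H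

  HasReflection : DSubset n → Set
  HasReflection H = ∃[ a ] (a , true) ∈ˢ H

  reflection-free⇒≢ : {H K : DSubset n} → (∀ a → ¬ (a , true) ∈ˢ H) → HasReflection K → H ≢ K
  reflection-free⇒≢ no-refl (a , a∈K) refl = no-refl a a∈K

  ⟨rᵖ,rⁱs⟩-reflection : (i : Fin p) → (ι i , true) ∈ˢ ⟨rᵖ,rⁱs⟩ i
  ⟨rᵖ,rⁱs⟩-reflection i = from (∈ˢ-fromDec (flip? i ∘ π) (ι i , true)) (reduce-ι i)

  ⟨rʲs⟩-reflection : (j : Fin n) → (j , true) ∈ˢ ⟨rʲs⟩ j
  ⟨rʲs⟩-reflection j = from (∈ˢ-fromDec (flip? j) (j , true)) refl

  ⟨rᵖ,rⁱs⟩-injective : ∀ {i i′} → ⟨rᵖ,rⁱs⟩ i ≡ ⟨rᵖ,rⁱs⟩ i′ → i ≡ i′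
  ⟨rᵖ,rⁱs⟩-injective {i} {i′} eq = trans (sym (reduce-ι i))
    (to (∈ˢ-fromDec (flip? i′ ∘ π) (ι i , true)) (subst ((ι i , true) ∈ˢ_) eq (⟨rᵖ,rⁱs⟩-reflection i)))

  ⟨rʲs⟩-injective : ∀ {j j′} → ⟨rʲs⟩ j ≡ ⟨rʲs⟩ j′ → j ≡ j′
  ⟨rʲs⟩-injective {j} {j′} eq =
    to (∈ˢ-fromDec (flip? j′) (j , true)) (subst ((j , true) ∈ˢ_) eq (⟨rʲs⟩-reflection j))

  ⟨rᵖ,rⁱs⟩≢⟨rʲs⟩ : ∀ i j → ⟨rᵖ,rⁱs⟩ i ≢ ⟨rʲs⟩ j
  ⟨rᵖ,rⁱs⟩≢⟨rʲs⟩ i j = separated rᵖ (from (∈ˢ-fromDec (flip? i ∘ π) rᵖ) reduce-p≡zero)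
    (λ rᵖ∈ → rᵖ≢ε (cong (_, false) (to (∈ˢ-fromDec (flip? j) rᵖ) rᵖ∈)))

  subgroups-unique : Unique subgroups
  subgroups-unique = (⟨rᵖ⟩≢⟨r⟩ ∷ All.tabulate (reflection-free⇒≢ ⟨rᵖ⟩-rotations ∘ reflective))
           ∷ All.tabulate (reflection-free⇒≢ ⟨r⟩-rotations ∘ reflective)
           ∷ Unique.++⁺ (Unique.map⁺ ⟨rᵖ,rⁱs⟩-injective (Unique.allFin⁺ p))
                        (Unique.map⁺ ⟨rʲs⟩-injective (Unique.allFin⁺ n)) disjoint
    where
    ⟨rᵖ⟩≢⟨r⟩ : ⟨rᵖ⟩ ≢ ⟨r⟩
    ⟨rᵖ⟩≢⟨r⟩ = separated r¹ (from (∈ˢ-fromDec rotation? r¹) tt)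
      (reduce-1≢zero ∘ to (∈ˢ-fromDec (trivial? ∘ π) r¹)) ∘ sym
    ⟨rᵖ⟩-rotations : ∀ a → ¬ (a , true) ∈ˢ ⟨rᵖ⟩
    ⟨rᵖ⟩-rotations a = to (∈ˢ-fromDec (trivial? ∘ π) (a , true))
    ⟨r⟩-rotations : ∀ a → ¬ (a , true) ∈ˢ ⟨r⟩
    ⟨r⟩-rotations a = to (∈ˢ-fromDec rotation? (a , true))
    reflective : ∀ {K} → K ∈ with-reflections → HasReflection K
    reflective K∈ with ∈-++⁻ (map ⟨rᵖ,rⁱs⟩ (allFin p)) {map ⟨rʲs⟩ (allFin n)} K∈
    ... | inj₁ K∈F with i , _ , refl ← ∈-map⁻ ⟨rᵖ,rⁱs⟩ {xs = allFin p} K∈F = ι i , ⟨rᵖ,rⁱs⟩-reflection i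
    ... | inj₂ K∈F with j , _ , refl ← ∈-map⁻ ⟨rʲs⟩ {xs = allFin n} K∈F = j , ⟨rʲs⟩-reflection j
    disjoint : Disjoint (map ⟨rᵖ,rⁱs⟩ (allFin p)) (map ⟨rʲs⟩ (allFin n))
    disjoint (K∈F , K∈F′) with i , _ , refl ← ∈-map⁻ ⟨rᵖ,rⁱs⟩ {xs = allFin p} K∈F
                             | j , _ , eq ← ∈-map⁻ ⟨rʲs⟩ {xs = allFin n} K∈F′ = ⟨rᵖ,rⁱs⟩≢⟨rʲs⟩ i j eq

  RotationShape : (Fin n → Set) → Set
  RotationShape R = (∀ a → R a) ⊎ (∀ a → R a ⇔ reduce a ≡ zero) ⊎ (∀ a → R a ⇔ a ≡ zero)

  reduce≡zero⇔ : (a : Fin n) → reduce a ≡ zero ⇔ p ∣ toℕ a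
  reduce≡zero⇔ a = mk⇔
    (λ eq → m%n≡0⇒n∣m (toℕ a) p (trans (sym (toℕ-reduce a)) (cong toℕ eq)))
    (λ p∣a → toℕ-injective (trans (toℕ-reduce a) (n∣m⇒m%n≡0 (toℕ a) p p∣a)))

  ∑-subgroups : (f : DSubset n → ℕ) →
    ∑[ H ∈ subgroups ] f H
      ≡ f ⟨rᵖ⟩ + (f ⟨r⟩ + (∑[ i ∈ allFin p ] f (⟨rᵖ,rⁱs⟩ i) + ∑[ j ∈ allFin n ] f (⟨rʲs⟩ j)))
  ∑-subgroups f = cong (λ s → f ⟨rᵖ⟩ + (f ⟨r⟩ + s))
    (trans (∑-++ f (map ⟨rᵖ,rⁱs⟩ (allFin p)) (map ⟨rʲs⟩ (allFin n)))
           (cong₂ _+_ (∑-map f ⟨rᵖ,rⁱs⟩ (allFin p)) (∑-map f ⟨rʲs⟩ (allFin n))))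

  ∑-allFin-const : ∀ m c → ∑[ i ∈ allFin m ] c ≡ m * c
  ∑-allFin-const m c = trans (∑-const c (allFin m)) (cong (_* c) (length-tabulate {n = m} id))

  length-subgroups : length subgroups ≡ 2 + (p + n)
  length-subgroups = cong (2 +_) (trans (length-++ (map ⟨rᵖ,rⁱs⟩ (allFin p)))
    (cong₂ _+_ (trans (length-map ⟨rᵖ,rⁱs⟩ (allFin p)) (length-tabulate id))
               (trans (length-map ⟨rʲs⟩ (allFin n)) (length-tabulate id))))

  adjacency : DSubset n → DSubset n → ℕ
  adjacency H K = 𝟙 (adjacent n H K)

  reflections : DSubset n → ℕ
  reflections H = ∑[ j ∈ allFin n ] 𝟙 ((j , true) ∈ᵇ H)

  row-∋rᵖ : (H : DSubset n) → rᵖ ∈ˢ H → ∑[ K ∈ subgroups ] adjacency H K ≡ (2 + p) + reflections H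
  row-∋rᵖ H rᵖ∈H = begin
    ∑[ K ∈ subgroups ] adjacency H K
      ≡⟨ ∑-subgroups (adjacency H) ⟩
    adjacency H ⟨rᵖ⟩ + (adjacency H ⟨r⟩ +
      (∑[ i ∈ allFin p ] adjacency H (⟨rᵖ,rⁱs⟩ i) + ∑[ j ∈ allFin n ] adjacency H (⟨rʲs⟩ j)))
      ≡⟨ cong₂ _+_ (meets (trivial? ∘ π) reduce-p≡zero)
           (cong₂ _+_ (meets rotation? tt)
             (cong₂ _+_ (trans (∑-cong (λ i → meets (flip? i ∘ π) reduce-p≡zero) (allFin p)) (∑-allFin-const p 1))
                        (∑-cong (λ j → cong 𝟙 (adjacent-Flip H j)) (allFin n)))) ⟩
    1 + (1 + (p * 1 + reflections H))
      ≡⟨ cong (λ k → 2 + (k + reflections H)) (*-identityʳ p) ⟩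
    (2 + p) + reflections H ∎
    where
    open ≡-Reasoning
    meets : {P : Dih n → Set} (P? : Decidable P) → P rᵖ → adjacency H (fromDec P?) ≡ 1
    meets P? P-rᵖ = cong 𝟙 (adjacent-at {H = H} {K = fromDec P?} rᵖ rᵖ≢ε rᵖ∈H (from (∈ˢ-fromDec P? rᵖ) P-rᵖ))

  row-⟨rʲs⟩ : (j : Fin n) → ∑[ K ∈ subgroups ] adjacency (⟨rʲs⟩ j) K ≡ 2
  row-⟨rʲs⟩ j = begin
    ∑[ K ∈ subgroups ] adjacency (⟨rʲs⟩ j) K
      ≡⟨ ∑-cong (λ K → cong 𝟙 (trans (adjacent-sym (⟨rʲs⟩ j) K) (adjacent-Flip K j))) subgroups ⟩
    ∑[ K ∈ subgroups ] 𝟙 ((j , true) ∈ᵇ K)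
      ≡⟨ ∑-subgroups (λ K → 𝟙 ((j , true) ∈ᵇ K)) ⟩
    𝟙 ((j , true) ∈ᵇ ⟨rᵖ⟩) + (𝟙 ((j , true) ∈ᵇ ⟨r⟩) +
      (∑[ i ∈ allFin p ] 𝟙 ((j , true) ∈ᵇ ⟨rᵖ,rⁱs⟩ i) + ∑[ j′ ∈ allFin n ] 𝟙 ((j , true) ∈ᵇ ⟨rʲs⟩ j′)))
      ≡⟨ cong₂ _+_ (cong 𝟙 (∈ᵇ-fromDec (trivial? ∘ π) (j , true)))
           (cong₂ _+_ (cong 𝟙 (∈ᵇ-fromDec rotation? (j , true)))
             (cong₂ _+_ (trans (∑-cong (λ i → cong 𝟙 (∈ᵇ-fromDec (flip? i ∘ π) (j , true))) (allFin p))
                               (count-unique _≟_ (Unique.allFin⁺ p) (∈-allFin (reduce j))))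
                        (trans (∑-cong (λ j′ → cong 𝟙 (∈ᵇ-fromDec (flip? j′) (j , true))) (allFin n))
                               (count-unique _≟_ (Unique.allFin⁺ n) (∈-allFin j))))) ⟩
    2 ∎
    where open ≡-Reasoning

  ∑-reflections-⟨rᵖ,rⁱs⟩ : ∑[ i ∈ allFin p ] reflections (⟨rᵖ,rⁱs⟩ i) ≡ n
  ∑-reflections-⟨rᵖ,rⁱs⟩ = begin
    ∑[ i ∈ allFin p ] ∑[ j ∈ allFin n ] 𝟙 ((j , true) ∈ᵇ ⟨rᵖ,rⁱs⟩ i)
      ≡⟨ ∑-comm (λ i j → 𝟙 ((j , true) ∈ᵇ ⟨rᵖ,rⁱs⟩ i)) (allFin p) (allFin n) ⟩
    ∑[ j ∈ allFin n ] ∑[ i ∈ allFin p ] 𝟙 ((j , true) ∈ᵇ ⟨rᵖ,rⁱs⟩ i)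
      ≡⟨ ∑-cong (λ j → trans (∑-cong (λ i → cong 𝟙 (∈ᵇ-fromDec (flip? i ∘ π) (j , true))) (allFin p))
                             (count-unique _≟_ (Unique.allFin⁺ p) (∈-allFin (reduce j)))) (allFin n) ⟩
    ∑[ j ∈ allFin n ] 1
      ≡⟨ trans (∑-allFin-const n 1) (*-identityʳ n) ⟩
    n ∎
    where open ≡-Reasoning

  reflections≡0 : ∀ {P : Dih n → Set} (P? : Decidable P) → (∀ a → ¬ P (a , true)) → reflections (fromDec P?) ≡ 0
  reflections≡0 P? no-reflection = trans
    (∑-cong (λ j → cong 𝟙 (trans (∈ᵇ-fromDec P? (j , true)) (dec-false (P? (j , true)) (no-reflection j)))) (allFin n))
    (trans (∑-allFin-const n 0) (*-zeroʳ n))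

  adjacency-sum : ∑[ H ∈ subgroups ] ∑[ K ∈ subgroups ] adjacency H K ≡ (2 + p) + ((2 + p) + (p * (2 + p) + n + n * 2))
  adjacency-sum = begin
    ∑[ H ∈ subgroups ] ∑[ K ∈ subgroups ] adjacency H K
      ≡⟨ ∑-subgroups (λ H → ∑[ K ∈ subgroups ] adjacency H K) ⟩
    row ⟨rᵖ⟩ + (row ⟨r⟩ + (∑[ i ∈ allFin p ] row (⟨rᵖ,rⁱs⟩ i) + ∑[ j ∈ allFin n ] row (⟨rʲs⟩ j)))
      ≡⟨ cong₂ _+_ (trans (row-∋rᵖ ⟨rᵖ⟩ (rᵖ-in (trivial? ∘ π) reduce-p≡zero))
                          (cong (2 + p +_) (reflections≡0 (trivial? ∘ π) (λ _ → id))))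
           (cong₂ _+_ (trans (row-∋rᵖ ⟨r⟩ (rᵖ-in rotation? tt))
                             (cong (2 + p +_) (reflections≡0 rotation? (λ _ → id))))
             (cong₂ _+_ ⟨rᵖ,rⁱs⟩-rows (trans (∑-cong row-⟨rʲs⟩ (allFin n)) (∑-allFin-const n 2)))) ⟩
    (2 + p + 0) + ((2 + p + 0) + (p * (2 + p) + n + n * 2))
      ≡⟨ cong₂ (λ a b → a + (b + (p * (2 + p) + n + n * 2))) (+-identityʳ (2 + p)) (+-identityʳ (2 + p)) ⟩
    (2 + p) + ((2 + p) + (p * (2 + p) + n + n * 2)) ∎
    where
    open ≡-Reasoning
    row : DSubset n → ℕ
    row H = ∑[ K ∈ subgroups ] adjacency H K
    rᵖ-in : {P : Dih n → Set} (P? : Decidable P) → P rᵖ → rᵖ ∈ˢ fromDec P?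
    rᵖ-in P? = from (∈ˢ-fromDec P? rᵖ)
    ⟨rᵖ,rⁱs⟩-rows : ∑[ i ∈ allFin p ] row (⟨rᵖ,rⁱs⟩ i) ≡ p * (2 + p) + n
    ⟨rᵖ,rⁱs⟩-rows = begin
      ∑[ i ∈ allFin p ] row (⟨rᵖ,rⁱs⟩ i)
        ≡⟨ ∑-cong (λ i → row-∋rᵖ (⟨rᵖ,rⁱs⟩ i) (rᵖ-in (flip? i ∘ π) reduce-p≡zero)) (allFin p) ⟩
      ∑[ i ∈ allFin p ] ((2 + p) + reflections (⟨rᵖ,rⁱs⟩ i))
        ≡⟨ ∑-distrib-+ (λ _ → 2 + p) (reflections ∘ ⟨rᵖ,rⁱs⟩) (allFin p) ⟩
      ∑[ i ∈ allFin p ] (2 + p) + ∑[ i ∈ allFin p ] reflections (⟨rᵖ,rⁱs⟩ i)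
        ≡⟨ cong₂ _+_ (∑-allFin-const p (2 + p)) ∑-reflections-⟨rᵖ,rⁱs⟩ ⟩
      p * (2 + p) + n ∎

  diagonal-sum : ∑[ H ∈ subgroups ] adjacency H H ≡ length subgroups
  diagonal-sum = begin
    ∑[ H ∈ subgroups ] adjacency H H ≡⟨ ∑-cong-∈ subgroups (cong 𝟙 ∘ nontrivial-self-adjacent ∘ nontrivial) ⟩
    ∑[ H ∈ subgroups ] 1             ≡⟨ ∑-const 1 subgroups ⟩
    length subgroups * 1             ≡⟨ *-identityʳ (length subgroups) ⟩
    length subgroups                 ∎
    where
    open ≡-Reasoning
    nontrivial : ∀ {H} → H ∈ subgroups → ∃[ x ] x ≢ ε × x ∈ˢ H
    nontrivial {H} H∈ = proj₂ (proj₂ (to (isVertex⇔ H) (subgroup⇒vertex H∈)))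

  module _ (p-prime : Prime p) where

    p∤⇒invertible : ∀ {t} → ¬ p ∣ t → ∃[ k ] k * t % n ≡ 1
    p∤⇒invertible p∤t = coprime⇒inverse _ (coprime-*ʳ t⊥p t⊥p)
      where t⊥p = prime∤⇒coprime p-prime p∤t

    p∣⇒generates-p : ∀ {t} → p ∣ t → t ≢ 0 → t < n → ∃[ k ] k * t % n ≡ p
    p∣⇒generates-p (divides u refl) up≢0 up<n = k , (begin
      k * (u * p) % n     ≡⟨ cong (_% n) (*-assoc k u p) ⟨
      k * u * p % (p * p) ≡⟨ m%n*o≡m*o%[n*o] (k * u) p p ⟨
      k * u % p * p       ≡⟨ cong (_* p) ku≡1 ⟩
      1 * p               ≡⟨ *-identityˡ p ⟩
      p                   ∎)
      where
      open ≡-Reasoning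
      instance _ = ≢-nonZero (λ u≡0 → up≢0 (cong (_* p) u≡0))
      inverse = coprime⇒inverse q (Coprime.sym (prime⇒coprime p-prime (*-cancelʳ-< p u p up<n)))
      k = proj₁ inverse
      ku≡1 = proj₂ inverse

    module RotationSubgroup {R : Fin n → Set} (R? : Decidable R) (R-zero : R zero)
                            (R-⊕ : ∀ a b → R a → R b → R (a ⊕ b)) where

      R-· : ∀ k {a} → R a → R (k · a)
      R-· zero    _  = R-zero
      R-· (suc k) Ra = R-⊕ _ _ Ra (R-· k Ra)

      R-multiple : ∀ {x} → R x → ∀ k c → k * toℕ x ≡ toℕ c → R c
      R-multiple Rx k c eq = subst R (k*a≡c⇒k·a≡c k eq) (R-· k Rx)

      trichotomy : RotationShape R
      trichotomy with any? (λ a → R? a ×-dec ¬? (reduce a ≟ zero))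
      ... | yes (a , Ra , reduce-a≢0) =
        inj₁ (λ c → R-multiple (R-· k Ra) (toℕ c) c (trans (cong (toℕ c *_) k·a≡1) (*-identityʳ (toℕ c))))
        where
        inverse = p∤⇒invertible (reduce-a≢0 ∘ from (reduce≡zero⇔ a))
        k = proj₁ inverse
        k·a≡1 : toℕ (k · a) ≡ 1
        k·a≡1 = trans (toℕ-· k a) (proj₂ inverse)
      ... | no no-unit with any? (λ a → R? a ×-dec ¬? (a ≟ zero))
      ...   | yes (a , Ra , a≢0) = inj₂ (inj₁ (λ c → mk⇔ (multiple c) (p∣⇒R c ∘ to (reduce≡zero⇔ c))))
        where
        multiple : ∀ c → R c → reduce c ≡ zero
        multiple c Rc = decidable-stable (reduce c ≟ zero) (λ reduce-c≢0 → no-unit (c , Rc , reduce-c≢0))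
        generator = p∣⇒generates-p (to (reduce≡zero⇔ a) (multiple a Ra))
                      (a≢0 ∘ toℕ-injective) (toℕ<n a)
        k = proj₁ generator
        k·a≡p : toℕ (k · a) ≡ p
        k·a≡p = trans (toℕ-· k a) (proj₂ generator)
        p∣⇒R : ∀ c → p ∣ toℕ c → R c
        p∣⇒R c p∣c = R-multiple (R-· k Ra) (toℕ c / p) c (trans (cong (toℕ c / p *_) k·a≡p) (m/n*n≡m p∣c))
      ...   | no only-zero = inj₂ (inj₂ (λ c → mk⇔ (zero-only c) (λ { refl → R-zero })))
        where
        zero-only : ∀ c → R c → c ≡ zero
        zero-only c Rc = decidable-stable (c ≟ zero) (λ c≢0 → only-zero (c , Rc , c≢0))

    module Classification (H : DSubset n) (H-vertex : T (isVertex n H)) where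

      R S : Fin n → Set
      R a = (a , false) ∈ˢ H
      S a = (a , true) ∈ˢ H

      H-subgroup : IsSubgroup (_∈ˢ H)
      H-subgroup = proj₁ (to (isVertex⇔ H) H-vertex)

      H-proper : ∃[ x ] ¬ x ∈ˢ H
      H-proper = proj₁ (proj₂ (to (isVertex⇔ H) H-vertex))

      H-nontrivial : ∃[ x ] x ≢ ε × x ∈ˢ H
      H-nontrivial = proj₂ (proj₂ (to (isVertex⇔ H) H-vertex))

      open IsSubgroup H-subgroup

      reflection-coset : ∀ {b} → S b → ∀ c → S c ⇔ R (c ⊖ b)
      reflection-coset {b} Sb c = mk⇔ (λ Sc → ∙-closed (c , true) (b , true) Sc Sb)
        (λ R-c⊖b → subst S (⊖-⊕-cancel c b) (∙-closed (c ⊖ b , false) (b , true) R-c⊖b Sb))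

      H≡fromDec : {P : Dih n → Set} (P? : Decidable P) →
        (∀ a → R a ⇔ P (a , false)) → (∀ a → S a ⇔ P (a , true)) → H ≡ fromDec P?
      H≡fromDec P? R⇔ S⇔ = DSubset-ext λ
        { (a , false) → ⇔.trans (R⇔ a) (⇔.sym (∈ˢ-fromDec P? (a , false)))
        ; (a , true)  → ⇔.trans (S⇔ a) (⇔.sym (∈ˢ-fromDec P? (a , true))) }

      no-reflection : ¬ (∃ S) → ∀ a → S a ⇔ ⊥
      no-reflection ¬S a = mk⇔ (λ Sa → ¬S (a , Sa)) ⊥-elim

      classify-by : RotationShape R → Dec (∃ S) → H ∈ subgroups
      classify-by (inj₁ all-R) (yes (b , Sb)) = ⊥-elim (x∉H (everything x))
        where
        x∉H = proj₂ H-proper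
        x = proj₁ H-proper
        everything : ∀ x → x ∈ˢ H
        everything (a , false) = all-R a
        everything (a , true)  = from (reflection-coset Sb a) (all-R (a ⊖ b))
      classify-by (inj₁ all-R) (no ¬S) =
        there (here (H≡fromDec rotation? (λ a → mk⇔ (λ _ → tt) (λ _ → all-R a)) (no-reflection ¬S)))
      classify-by (inj₂ (inj₁ R⇔p∣)) (yes (b , Sb)) =
        there (there (subst (_∈ with-reflections) (sym (H≡fromDec (flip? (reduce b) ∘ π) R⇔p∣ S⇔)) ⟨rᵖ,rⁱs⟩∈))
        where
        S⇔ : ∀ a → S a ⇔ (reduce a ≡ reduce b)
        S⇔ a = ⇔.trans (reflection-coset Sb a) (⇔.trans (R⇔p∣ (a ⊖ b))
                 (⇔.trans (mk⇔ (trans (sym (reduce-⊖ a b))) (trans (reduce-⊖ a b))) ⊖≡zero⇔≡))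
        ⟨rᵖ,rⁱs⟩∈ : ⟨rᵖ,rⁱs⟩ (reduce b) ∈ with-reflections
        ⟨rᵖ,rⁱs⟩∈ = ∈-++⁺ˡ (∈-map⁺ ⟨rᵖ,rⁱs⟩ (∈-allFin (reduce b)))
      classify-by (inj₂ (inj₁ R⇔p∣)) (no ¬S) = here (H≡fromDec (trivial? ∘ π) R⇔p∣ (no-reflection ¬S))
      classify-by (inj₂ (inj₂ R⇔0)) (yes (b , Sb)) =
        there (there (subst (_∈ with-reflections) (sym (H≡fromDec (flip? b) R⇔0 S⇔)) ⟨rʲs⟩∈))
        where
        S⇔ : ∀ a → S a ⇔ (a ≡ b)
        S⇔ a = ⇔.trans (reflection-coset Sb a) (⇔.trans (R⇔0 (a ⊖ b)) ⊖≡zero⇔≡)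
        ⟨rʲs⟩∈ : ⟨rʲs⟩ b ∈ with-reflections
        ⟨rʲs⟩∈ = ∈-++⁺ʳ (map ⟨rᵖ,rⁱs⟩ (allFin p)) (∈-map⁺ ⟨rʲs⟩ (∈-allFin b))
      classify-by (inj₂ (inj₂ R⇔0)) (no ¬S) = ⊥-elim (trivial H-nontrivial)
        where
        trivial : ¬ (∃[ x ] x ≢ ε × x ∈ˢ H)
        trivial ((a , false) , x≢ε , Ra) = x≢ε (cong (_, false) (to (R⇔0 a) Ra))
        trivial ((a , true)  , _   , Sa) = ¬S (a , Sa)

      classify : H ∈ subgroups
      classify = classify-by
        (RotationSubgroup.trichotomy (λ a → T? ((a , false) ∈ᵇ H)) ε∈ (λ a b → ∙-closed (a , false) (b , false)))
        (any? (λ b → T? ((b , true) ∈ᵇ H)))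

    vertices↭subgroups : vertices n ↭ subgroups
    vertices↭subgroups = vertices-↭ subgroups-unique (λ {H} → mk⇔ subgroup⇒vertex (Classification.classify H))


    twice-numEdges : 2 * numEdges n ≡ 3 * n + 3 * p + 2
    twice-numEdges = +-cancelʳ-≡ (length subgroups) _ _ (begin
      2 * numEdges n + length subgroups
        ≡⟨ cong (λ e → 2 * e + length subgroups) (edgeCount-↭ (adjacent n) adjacent-sym vertices↭subgroups) ⟩
      2 * edgeCount (adjacent n) subgroups + length subgroups
        ≡⟨ cong (2 * edgeCount (adjacent n) subgroups +_) diagonal-sum ⟨
      2 * edgeCount (adjacent n) subgroups + ∑[ H ∈ subgroups ] adjacency H H
        ≡⟨ double-counting (adjacent n) adjacent-sym subgroups ⟩
      ∑[ H ∈ subgroups ] ∑[ K ∈ subgroups ] adjacency H K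
        ≡⟨ adjacency-sum ⟩
      (2 + p) + ((2 + p) + (p * (2 + p) + n + n * 2))
        ≡⟨ arithmetic p ⟩
      3 * n + 3 * p + 2 + (2 + (p + n))
        ≡⟨ cong (3 * n + 3 * p + 2 +_) length-subgroups ⟨
      3 * n + 3 * p + 2 + length subgroups ∎)
      where
      open ≡-Reasoning
      arithmetic : ∀ p → (2 + p) + ((2 + p) + (p * (2 + p) + p * p + p * p * 2))
                       ≡ 3 * (p * p) + 3 * p + 2 + (2 + (p + p * p))
      arithmetic = solve-∀

theorem2p3 : (p : ℕ) → Prime p →
    2 * numEdges (p ^ 2) ≡ 3 * p ^ 2 + 3 * p + 2
theorem2p3 (2+ q) p-prime =
  subst (λ n → 2 * numEdges n ≡ 3 * n + 3 * 2+ q + 2) (sym p²≡p*p) (D2p².twice-numEdges q p-prime)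
  where
  p²≡p*p : 2+ q ^ 2 ≡ 2+ q * 2+ q
  p²≡p*p = cong (2+ q *_) (*-identityʳ (2+ q))
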